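{- Let $k\ge 4$ and let $H_k$ be the thin headless spider on $2k$ vertices. Then $\gamma^{\rm L}(H_k)=\gamma^{\rm O}(H_k)=k-1$, $\gamma^{\rm I}(H_k)=k+1$, and $\gamma^{\rm F}(H_k)=2k-2$.
   Context: The thin headless spider $H_k$ has vertex set $Q\cup S$ with $Q=\{q_1,\dots,q_k\}$, $S=\{s_1,\dots,s_k\}$, where $Q$ induces a clique, $S$ induces a stable set, and $q_i$ is adjacent to $s_j$ iff $i=j$. For a graph $G=(V,E)$, $N(v)$ denotes the open and $N[v]=N(v)\cup\{v\}$ the closed neighborhood of $v$. A set $C\subseteq V$ is: a locating set (L-set) if the sets $N(v)\cap C$, $v\in V\setminus C$, are pairwise distinct; an open-separating set (O-set) if the sets $N(v)\cap C$, $v\in V$, are pairwise distinct; a closed-separating set (I-set) if the sets $N[v]\cap C$, $v\in V$, are pairwise distinct; a full-separating set (F-set) if it is both an O-set and an I-set. $\gamma^{\rm S}(G)$ is the minimum cardinality of an S-set of $G$. -}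

module Defs where

open import Data.Nat using (ℕ; _+_)
open import Data.Bool using (Bool; true; false; _∧_; _∨_; not)
open import Data.Fin using (Fin; splitAt; _≟_)
open import Data.Fin.Subset using (Subset; _∈_; _∉_; ∣_∣; _∩_)
open import Data.Vec using (tabulate)
open import Data.Sum using (inj₁; inj₂)
open import Data.Product using (Σ; _×_)
open import Relation.Binary.PropositionalEquality as Eq using (_≡_; _≢_; refl; cong)
open import Relation.Nullary using (yes; no)
open import Data.Empty using (⊥-elim)
open import Relation.Nullary.Decidable using (⌊_⌋)

record Graph (n : ℕ) : Set where
  field
    adj   : Fin n → Fin n → Bool
    sym   : ∀ u v → adj u v ≡ adj v u
    irrefl : ∀ v → adj v v ≡ false

open Graph public

N : ∀ {n} → Graph n → Fin n → Subset n
N G v = tabulate (λ w → adj G v w)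

N[_] : ∀ {n} → Graph n → Fin n → Subset n
N[ G ] v = tabulate (λ w → adj G v w ∨ ⌊ v ≟ w ⌋)

IsLSet : ∀ {n} → Graph n → Subset n → Set
IsLSet G C = ∀ u v → u ∉ C → v ∉ C → u ≢ v → N G u ∩ C ≢ N G v ∩ C

IsOSet : ∀ {n} → Graph n → Subset n → Set
IsOSet G C = ∀ u v → u ≢ v → N G u ∩ C ≢ N G v ∩ C

IsISet : ∀ {n} → Graph n → Subset n → Set
IsISet G C = ∀ u v → u ≢ v → N[ G ] u ∩ C ≢ N[ G ] v ∩ C

IsFSet : ∀ {n} → Graph n → Subset n → Set
IsFSet G C = IsOSet G C × IsISet G C

IsMinCard : ∀ {n} → (Subset n → Set) → ℕ → Set
IsMinCard {n} P m =
  Σ (Subset n) (λ C → P C × ∣ C ∣ ≡ m) × (∀ C → P C → m Data.Nat.≤ ∣ C ∣)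

-- Thin headless spider H_k on Fin (k + k):
-- vertices splitAt k = inj₁ i are q_i, inj₂ i are s_i.
spiderAdj : (k : ℕ) → Fin (k + k) → Fin (k + k) → Bool
spiderAdj k u v with splitAt k u | splitAt k v
... | inj₁ i | inj₁ j = not ⌊ i ≟ j ⌋
... | inj₁ i | inj₂ j = ⌊ i ≟ j ⌋
... | inj₂ i | inj₁ j = ⌊ i ≟ j ⌋
... | inj₂ i | inj₂ j = false

private
  ≟-sym : ∀ {m} (i j : Fin m) → ⌊ i ≟ j ⌋ ≡ ⌊ j ≟ i ⌋
  ≟-sym i j with i ≟ j | j ≟ i
  ... | yes _ | yes _ = refl
  ... | no _  | no _  = refl
  ... | yes p | no q  = ⊥-elim (q (Eq.sym p))
  ... | no p  | yes q = ⊥-elim (p (Eq.sym q))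

  ≟-refl : ∀ {m} (i : Fin m) → ⌊ i ≟ i ⌋ ≡ true
  ≟-refl i with i ≟ i
  ... | yes _ = refl
  ... | no p  = ⊥-elim (p refl)

  spiderSym : (k : ℕ) → ∀ u v → spiderAdj k u v ≡ spiderAdj k v u
  spiderSym k u v with splitAt k u | splitAt k v
  ... | inj₁ i | inj₁ j = cong not (≟-sym i j)
  ... | inj₁ i | inj₂ j = ≟-sym i j
  ... | inj₂ i | inj₁ j = ≟-sym i j
  ... | inj₂ i | inj₂ j = refl

  spiderIrr : (k : ℕ) → ∀ v → spiderAdj k v v ≡ false
  spiderIrr k v with splitAt k v
  ... | inj₁ i rewrite ≟-refl i = refl
  ... | inj₂ i = refl

H : (k : ℕ) → Graph (k + k)
H k = record { adj = spiderAdj k ; sym = spiderSym k ; irrefl = spiderIrr k }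

{-# OPTIONS --safe #-}
-- Since N(s i) ∩ C = {q i} ∩ C,
-- two indices i ≢ j with q i, q j ∉ C leave s i and s j with the same open trace; since
-- N[q i] ∩ C = (Q ∩ C) ∪ ({s i} ∩ C), two indices with s i, s j ∉ C leave q i and q j with the
-- same closed trace, and Q ∩ C ⊆ {q i} gives N[q i] ∩ C = N[s i] ∩ C.  So an L-set misses both
-- q i and s i for at most one i, an O-set misses at most one q i, and an I-set misses at most
-- one s i and contains two vertices of Q: the lower bounds k ∸ 1, k ∸ 1, k + 1 and 2k ∸ 2.
-- They are attained by Q ∖ {q 0}, {q 1, q 2} ∪ S ∖ {s 0} and (Q ∖ {q 0}) ∪ (S ∖ {s 0}).
module Submission where

open import Defs hiding (sym)
open import Data.Nat using (ℕ; zero; suc; _+_; _∸_; _≤_; _<_; z≤n; s≤s)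
open import Data.Nat.Properties
  using (≤-trans; ≤-reflexive; ≤-<-trans; _≤?_; ≰⇒>; <⇒≱; m∸n≤m; +-comm; +-suc; +-identityʳ
        ; +-mono-≤; +-monoʳ-≤; module ≤-Reasoning)
open import Data.Bool using (Bool; true; false; _∧_; _∨_; not)
open import Data.Bool.Properties using (∧-zeroʳ; ∧-identityʳ; ∨-identityʳ; ∨-inverseˡ)
open import Data.Empty using (⊥-elim)
open import Data.Fin using (Fin; zero; suc; splitAt; _↑ˡ_; _↑ʳ_)
open import Data.Fin.Properties
  using (_≟_; any?; splitAt-↑ˡ; splitAt-↑ʳ; join-splitAt; ↑ˡ-injective; ↑ʳ-injective)
open import Data.Fin.Subset
  using (Subset; inside; outside; _∈_; _∉_; _⊆_; _⊈_; ∣_∣; _∩_; _∪_; ∁; ⁅_⁆; ⊤; ⊥)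
open import Data.Fin.Subset.Properties
  using ( _∈?_; ∣⊤∣≡n; ∣⊥∣≡0; ∣⁅x⁆∣≡1; ∣∁p∣≡n∸∣p∣; ∣p∣≤∣x∷p∣; p⊆q⇒∣p∣≤∣q∣; p⊂q⇒∣p∣<∣q∣
        ; x∈⁅x⁆; x∈⁅y⁆⇒x≡y; x≢y⇒x∉⁅y⁆; x∉p⇒x∈∁p; x∈∁p⇒x∉p; x∈p∪q⁺)
open import Data.Product using (_×_; ∃; _,_; proj₂; map₂)
open import Data.Sum using (inj₁; inj₂)
open import Data.Vec as Vec using (_∷_; []; _++_; tabulate; here; there)
open import Data.Vec.Properties
  using (lookup-++ˡ; lookup-++ʳ; []=⇒lookup; lookup⇒[]=; ∷-injectiveˡ; ∷-injectiveʳ)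
open import Function using (_∘_)
open import Relation.Binary.PropositionalEquality
  using (_≡_; _≢_; refl; sym; trans; cong; cong₂; subst; ≢-sym; module ≡-Reasoning)
open import Relation.Nullary using (¬_; Dec; yes; no; contradiction)
open import Relation.Nullary.Decidable
  using (⌊_⌋; ¬?; _×-dec_; dec-true; dec-false; decidable-stable; isYes≗does)

∣p++q∣≡∣p∣+∣q∣ : ∀ {m n} (p : Subset m) (q : Subset n) → ∣ p ++ q ∣ ≡ ∣ p ∣ + ∣ q ∣
∣p++q∣≡∣p∣+∣q∣ []            q = refl
∣p++q∣≡∣p∣+∣q∣ (inside  ∷ p) q = cong suc (∣p++q∣≡∣p∣+∣q∣ p q)
∣p++q∣≡∣p∣+∣q∣ (outside ∷ p) q = ∣p++q∣≡∣p∣+∣q∣ p q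

∣p∪q∣≤∣p∣+∣q∣ : ∀ {n} (p q : Subset n) → ∣ p ∪ q ∣ ≤ ∣ p ∣ + ∣ q ∣
∣p∪q∣≤∣p∣+∣q∣ []            []            = z≤n
∣p∪q∣≤∣p∣+∣q∣ (inside  ∷ p) (x ∷ q)       =
  s≤s (≤-trans (∣p∪q∣≤∣p∣+∣q∣ p q) (+-monoʳ-≤ ∣ p ∣ (∣p∣≤∣x∷p∣ x q)))
∣p∪q∣≤∣p∣+∣q∣ (outside ∷ p) (inside  ∷ q) =
  ≤-trans (s≤s (∣p∪q∣≤∣p∣+∣q∣ p q)) (≤-reflexive (sym (+-suc ∣ p ∣ ∣ q ∣)))
∣p∪q∣≤∣p∣+∣q∣ (outside ∷ p) (outside ∷ q) = ∣p∪q∣≤∣p∣+∣q∣ p q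

∣∁⁅x⁆∣≡n∸1 : ∀ {n} (x : Fin n) → ∣ ∁ ⁅ x ⁆ ∣ ≡ n ∸ 1
∣∁⁅x⁆∣≡n∸1 {n} x = trans (∣∁p∣≡n∸∣p∣ ⁅ x ⁆) (cong (n ∸_) (∣⁅x⁆∣≡1 x))

x≢y⇒x∈∁⁅y⁆ : ∀ {n} {x y : Fin n} → x ≢ y → x ∈ ∁ ⁅ y ⁆
x≢y⇒x∈∁⁅y⁆ = x∉p⇒x∈∁p ∘ x≢y⇒x∉⁅y⁆

∈-++⁺ˡ : ∀ {m n} {p : Subset m} {q : Subset n} {x} → x ∈ p → x ↑ˡ n ∈ p ++ q
∈-++⁺ˡ {p = p} {q} {x} x∈p = lookup⇒[]= _ (p ++ q) (trans (lookup-++ˡ p q x) ([]=⇒lookup x∈p))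

∈-++⁺ʳ : ∀ {m n} {p : Subset m} {q : Subset n} {x} → x ∈ q → m ↑ʳ x ∈ p ++ q
∈-++⁺ʳ {p = p} {q} {x} x∈q = lookup⇒[]= _ (p ++ q) (trans (lookup-++ʳ p q x) ([]=⇒lookup x∈q))

∈-++⁻ˡ : ∀ {m n} {p : Subset m} {q : Subset n} {x} → x ↑ˡ n ∈ p ++ q → x ∈ p
∈-++⁻ˡ {p = p} {q} {x} x∈p++q = lookup⇒[]= x p (trans (sym (lookup-++ˡ p q x)) ([]=⇒lookup x∈p++q))

∈-++⁻ʳ : ∀ {m n} {p : Subset m} {q : Subset n} {x} → m ↑ʳ x ∈ p ++ q → x ∈ q
∈-++⁻ʳ {p = p} {q} {x} x∈p++q = lookup⇒[]= x q (trans (sym (lookup-++ʳ p q x)) ([]=⇒lookup x∈p++q))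

bound-via-++ : ∀ {m n b} {P : Subset (m + n) → Set} →
  (∀ p q → P (p ++ q) → b ≤ ∣ p ∣ + ∣ q ∣) → ∀ C → P C → b ≤ ∣ C ∣
bound-via-++ {m} bound C PC with Vec.splitAt m C
... | p , q , refl = ≤-trans (bound p q PC) (≤-reflexive (sym (∣p++q∣≡∣p∣+∣q∣ p q)))

p⊈q⇒∃x∈p∖q : ∀ {n} {p q : Subset n} → p ⊈ q → ∃ λ x → x ∈ p × x ∉ q
p⊈q⇒∃x∈p∖q {p = p} {q} p⊈q with any? (λ x → x ∈? p ×-dec ¬? (x ∈? q))
... | yes x∈p∖q = x∈p∖q
... | no ∄x∈p∖q = ⊥-elim (p⊈q λ {x} x∈p →
  decidable-stable (x ∈? q) (λ x∉q → ∄x∈p∖q (x , x∈p , x∉q)))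

∣p∣<n⇒∃x∉p : ∀ {n} (p : Subset n) → ∣ p ∣ < n → ∃ λ x → x ∉ p
∣p∣<n⇒∃x∉p {n} p ∣p∣<n = map₂ proj₂ (p⊈q⇒∃x∈p∖q ⊤⊈p)
  where
  ⊤⊈p : ⊤ ⊈ p
  ⊤⊈p ⊤⊆p = <⇒≱ ∣p∣<n (subst (_≤ ∣ p ∣) (∣⊤∣≡n n) (p⊆q⇒∣p∣≤∣q∣ ⊤⊆p))

∣⁅x⁆∪⁅y⁆∪⁅z⁆∣≤3 : ∀ {n} (x y z : Fin n) → ∣ ⁅ x ⁆ ∪ ⁅ y ⁆ ∪ ⁅ z ⁆ ∣ ≤ 3
∣⁅x⁆∪⁅y⁆∪⁅z⁆∣≤3 x y z = begin
  ∣ ⁅ x ⁆ ∪ ⁅ y ⁆ ∪ ⁅ z ⁆ ∣          ≤⟨ ∣p∪q∣≤∣p∣+∣q∣ ⁅ x ⁆ _ ⟩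
  ∣ ⁅ x ⁆ ∣ + ∣ ⁅ y ⁆ ∪ ⁅ z ⁆ ∣      ≤⟨ +-monoʳ-≤ ∣ ⁅ x ⁆ ∣ (∣p∪q∣≤∣p∣+∣q∣ ⁅ y ⁆ ⁅ z ⁆) ⟩
  ∣ ⁅ x ⁆ ∣ + (∣ ⁅ y ⁆ ∣ + ∣ ⁅ z ⁆ ∣) ≡⟨ cong₂ _+_ (∣⁅x⁆∣≡1 x) (cong₂ _+_ (∣⁅x⁆∣≡1 y) (∣⁅x⁆∣≡1 z)) ⟩
  3                                  ∎
  where open ≤-Reasoning

∃-≢₃ : ∀ {n} → 3 < n → (x y z : Fin n) → ∃ λ t → t ≢ x × t ≢ y × t ≢ z
∃-≢₃ 3<n x y z with ∣p∣<n⇒∃x∉p (⁅ x ⁆ ∪ ⁅ y ⁆ ∪ ⁅ z ⁆) (≤-<-trans (∣⁅x⁆∪⁅y⁆∪⁅z⁆∣≤3 x y z) 3<n)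
... | t , t∉xyz = t , (λ { refl → t∉xyz (x∈p∪q⁺ (inj₁ (x∈⁅x⁆ t))) })
                    , (λ { refl → t∉xyz (x∈p∪q⁺ (inj₂ (x∈p∪q⁺ (inj₁ (x∈⁅x⁆ t))))) })
                    , (λ { refl → t∉xyz (x∈p∪q⁺ (inj₂ (x∈p∪q⁺ (inj₂ (x∈⁅x⁆ t))))) })

AtMostOneMissing : ∀ {n} → Subset n → Set
AtMostOneMissing p = ∀ {x y} → x ∉ p → y ∉ p → x ≡ y

atMostOneMissing⇒n∸1≤∣p∣ : ∀ {n} {p : Subset n} → AtMostOneMissing p → n ∸ 1 ≤ ∣ p ∣
atMostOneMissing⇒n∸1≤∣p∣ {n} {p} missing≤1 with n ≤? ∣ p ∣
... | yes n≤∣p∣ = ≤-trans (m∸n≤m n 1) n≤∣p∣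
... | no n≰∣p∣ with ∣p∣<n⇒∃x∉p p (≰⇒> n≰∣p∣)
...   | x , x∉p = begin
  n ∸ 1         ≡⟨ ∣∁⁅x⁆∣≡n∸1 x ⟨
  ∣ ∁ ⁅ x ⁆ ∣   ≤⟨ p⊆q⇒∣p∣≤∣q∣ ∁⁅x⁆⊆p ⟩
  ∣ p ∣         ∎
  where
  open ≤-Reasoning
  ∁⁅x⁆⊆p : ∁ ⁅ x ⁆ ⊆ p
  ∁⁅x⁆⊆p {y} y∈∁⁅x⁆ = decidable-stable (y ∈? p) λ y∉p →
    x∈∁p⇒x∉p y∈∁⁅x⁆ (subst (_∈ ⁅ x ⁆) (missing≤1 x∉p y∉p) (x∈⁅x⁆ x))

2≤∣p∣ : ∀ {n} {p : Subset (suc n)} → (∀ x → p ⊈ ⁅ x ⁆) → 2 ≤ ∣ p ∣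
2≤∣p∣ {p = p} p⊈⁅_⁆ with p⊈q⇒∃x∈p∖q (p⊈⁅ zero ⁆)
... | y , y∈p , _ with p⊈q⇒∃x∈p∖q (p⊈⁅ y ⁆)
...   | z , z∈p , z∉⁅y⁆ = subst (_< ∣ p ∣) (∣⁅x⁆∣≡1 y) (p⊂q⇒∣p∣<∣q∣ (⁅y⁆⊆p , z , z∈p , z∉⁅y⁆))
  where
  ⁅y⁆⊆p : ⁅ y ⁆ ⊆ p
  ⁅y⁆⊆p x∈⁅y⁆ = subst (_∈ p) (sym (x∈⁅y⁆⇒x≡y y x∈⁅y⁆)) y∈p

⌊⌋-true : ∀ {a} {A : Set a} (a? : Dec A) → A → ⌊ a? ⌋ ≡ true
⌊⌋-true a? a = trans (isYes≗does a?) (dec-true a? a)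

⌊⌋-false : ∀ {a} {A : Set a} (a? : Dec A) → ¬ A → ⌊ a? ⌋ ≡ false
⌊⌋-false a? ¬a = trans (isYes≗does a?) (dec-false a? ¬a)

⌊≟⌋-injective : ∀ {m n} {f : Fin m → Fin n} → (∀ {i j} → f i ≡ f j → i ≡ j) →
  ∀ i j → ⌊ f i ≟ f j ⌋ ≡ ⌊ i ≟ j ⌋
⌊≟⌋-injective {f = f} f-injective i j with i ≟ j
... | yes refl = ⌊⌋-true (f i ≟ f i) refl
... | no i≢j   = ⌊⌋-false (f i ≟ f j) (i≢j ∘ f-injective)

Separates : ∀ {n} → Subset n → (f g : Fin n → Bool) → Set
Separates C f g = ∃ λ w → w ∈ C × f w ≢ g w

separates : ∀ {n} {C : Subset n} {f g w} → w ∈ C → f w ≡ true → g w ≡ false → Separates C f g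
separates w∈C fw≡true gw≡false =
  _ , w∈C , λ fw≡gw → contradiction (trans (sym fw≡true) (trans fw≡gw gw≡false)) λ ()

Separates-sym : ∀ {n} {C : Subset n} {f g} → Separates C f g → Separates C g f
Separates-sym (w , w∈C , fw≢gw) = w , w∈C , ≢-sym fw≢gw

separated-avoiding : ∀ {m n} {C : Subset n} (r : Fin m) (f : Fin m → Fin n → Bool) →
  (∀ {i j} → i ≢ j → i ≢ r → Separates C (f i) (f j)) →
  ∀ {i j} → i ≢ j → Separates C (f i) (f j)
separated-avoiding r f separated {i} {j} i≢j with i ≟ r
... | no i≢r   = separated i≢j i≢r
... | yes refl = Separates-sym (separated (≢-sym i≢j) (≢-sym i≢j))

tabulate-∩-cong : ∀ {n} {f g : Fin n → Bool} (C : Subset n) →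
  (∀ {w} → w ∈ C → f w ≡ g w) → tabulate f ∩ C ≡ tabulate g ∩ C
tabulate-∩-cong []            _   = refl
tabulate-∩-cong (inside  ∷ C) f≗g =
  cong₂ _∷_ (cong (_∧ true) (f≗g here)) (tabulate-∩-cong C (f≗g ∘ there))
tabulate-∩-cong (outside ∷ C) f≗g =
  cong₂ _∷_ (trans (∧-zeroʳ _) (sym (∧-zeroʳ _))) (tabulate-∩-cong C (f≗g ∘ there))

tabulate-∩-separated : ∀ {n} {f g : Fin n → Bool} {C : Subset n} →
  Separates C f g → tabulate f ∩ C ≢ tabulate g ∩ C
tabulate-∩-separated (zero  , here       , fw≢gw) eq =
  fw≢gw (trans (sym (∧-identityʳ _)) (trans (∷-injectiveˡ eq) (∧-identityʳ _)))
tabulate-∩-separated (suc w , there w∈C , fw≢gw) eq =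
  tabulate-∩-separated (w , w∈C , fw≢gw) (∷-injectiveʳ eq)

adj[_] : ∀ {n} → Graph n → Fin n → Fin n → Bool
adj[ G ] u v = adj G u v ∨ ⌊ u ≟ v ⌋

module _ {n} (G : Graph n) {C : Subset n} where

  IsOSet⇒IsLSet : IsOSet G C → IsLSet G C
  IsOSet⇒IsLSet isO u v _ _ = isO u v

  separating⇒IsOSet : (∀ {u v} → u ≢ v → Separates C (adj G u) (adj G v)) → IsOSet G C
  separating⇒IsOSet separating u v u≢v = tabulate-∩-separated (separating u≢v)

  separating⇒IsISet : (∀ {u v} → u ≢ v → Separates C (adj[ G ] u) (adj[ G ] v)) → IsISet G C
  separating⇒IsISet separating u v u≢v = tabulate-∩-separated (separating u≢v)

module _ {k : ℕ} where

  q s : Fin k → Fin (k + k)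
  q i = i ↑ˡ k
  s i = k ↑ʳ i

  data Vertex : Fin (k + k) → Set where
    isQ : ∀ i → Vertex (q i)
    isS : ∀ i → Vertex (s i)

  vertex : ∀ u → Vertex u
  vertex u with splitAt k u | join-splitAt k k u
  ... | inj₁ i | refl = isQ i
  ... | inj₂ i | refl = isS i

  q≢s : ∀ i j → q i ≢ s j
  q≢s i j qi≡sj
    with trans (sym (splitAt-↑ˡ k i k)) (trans (cong (splitAt k) qi≡sj) (splitAt-↑ʳ k k j))
  ... | ()

  adj-q-q : ∀ i j → adj (H k) (q i) (q j) ≡ not ⌊ i ≟ j ⌋
  adj-q-q i j rewrite splitAt-↑ˡ k i k | splitAt-↑ˡ k j k = refl

  adj-q-s : ∀ i j → adj (H k) (q i) (s j) ≡ ⌊ i ≟ j ⌋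
  adj-q-s i j rewrite splitAt-↑ˡ k i k | splitAt-↑ʳ k k j = refl

  adj-s-q : ∀ i j → adj (H k) (s i) (q j) ≡ ⌊ i ≟ j ⌋
  adj-s-q i j rewrite splitAt-↑ʳ k k i | splitAt-↑ˡ k j k = refl

  adj-s-s : ∀ i j → adj (H k) (s i) (s j) ≡ false
  adj-s-s i j rewrite splitAt-↑ʳ k k i | splitAt-↑ʳ k k j = refl

  adj[]-q-q : ∀ i j → adj[ H k ] (q i) (q j) ≡ true
  adj[]-q-q i j = trans (cong₂ _∨_ (adj-q-q i j) (⌊≟⌋-injective (↑ˡ-injective k _ _) i j))
                        (∨-inverseˡ ⌊ i ≟ j ⌋)

  adj[]-q-s : ∀ i j → adj[ H k ] (q i) (s j) ≡ ⌊ i ≟ j ⌋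
  adj[]-q-s i j = trans (cong₂ _∨_ (adj-q-s i j) (⌊⌋-false (q i ≟ s j) (q≢s i j))) (∨-identityʳ _)

  adj[]-s-q : ∀ i j → adj[ H k ] (s i) (q j) ≡ ⌊ i ≟ j ⌋
  adj[]-s-q i j =
    trans (cong₂ _∨_ (adj-s-q i j) (⌊⌋-false (s i ≟ q j) (≢-sym (q≢s j i)))) (∨-identityʳ _)

  adj[]-s-s : ∀ i j → adj[ H k ] (s i) (s j) ≡ ⌊ i ≟ j ⌋
  adj[]-s-s i j =
    trans (cong (_∨ ⌊ s i ≟ s j ⌋) (adj-s-s i j)) (⌊≟⌋-injective (↑ʳ-injective k _ _) i j)

  module _ {C : Subset (k + k)} where

    N-s-∩-≡ : ∀ {i j} → q i ∉ C → q j ∉ C → N (H k) (s i) ∩ C ≡ N (H k) (s j) ∩ C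
    N-s-∩-≡ qi∉C qj∉C = tabulate-∩-cong C λ w∈C → trans (off qi∉C w∈C) (sym (off qj∉C w∈C))
      where
      off : ∀ {i w} → q i ∉ C → w ∈ C → adj (H k) (s i) w ≡ false
      off {i} {w} qi∉C w∈C with vertex w
      ... | isQ t = trans (adj-s-q i t) (⌊⌋-false (i ≟ t) λ { refl → qi∉C w∈C })
      ... | isS t = adj-s-s i t

    N[q]-∩-≡ : ∀ {i j} → s i ∉ C → s j ∉ C → N[ H k ] (q i) ∩ C ≡ N[ H k ] (q j) ∩ C
    N[q]-∩-≡ {i} {j} si∉C sj∉C = tabulate-∩-cong C agree
      where
      off : ∀ {i t} → s i ∉ C → s t ∈ C → adj[ H k ] (q i) (s t) ≡ false
      off {i} {t} si∉C st∈C = trans (adj[]-q-s i t) (⌊⌋-false (i ≟ t) λ { refl → si∉C st∈C })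
      agree : ∀ {w} → w ∈ C → adj[ H k ] (q i) w ≡ adj[ H k ] (q j) w
      agree {w} w∈C with vertex w
      ... | isQ t = trans (adj[]-q-q i t) (sym (adj[]-q-q j t))
      ... | isS t = trans (off si∉C w∈C) (sym (off sj∉C w∈C))

    N[q]-∩-≡-N[s] : ∀ {i} → (∀ {t} → q t ∈ C → t ≡ i) → N[ H k ] (q i) ∩ C ≡ N[ H k ] (s i) ∩ C
    N[q]-∩-≡-N[s] {i} C∩Q⊆qi = tabulate-∩-cong C agree
      where
      agree : ∀ {w} → w ∈ C → adj[ H k ] (q i) w ≡ adj[ H k ] (s i) w
      agree {w} w∈C with vertex w
      ... | isQ t = trans (adj[]-q-q i t)
                          (sym (trans (adj[]-s-q i t) (⌊⌋-true (i ≟ t) (sym (C∩Q⊆qi w∈C)))))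
      ... | isS t = trans (adj[]-q-s i t) (sym (adj[]-s-s i t))

  module _ (CQ CS : Subset k) where

    IsLSet⇒AtMostOneMissing∪ : IsLSet (H k) (CQ ++ CS) → AtMostOneMissing (CQ ∪ CS)
    IsLSet⇒AtMostOneMissing∪ isL {i} {j} i∉ j∉ = decidable-stable (i ≟ j) λ i≢j →
      isL (s i) (s j) (s∉ i∉) (s∉ j∉) (i≢j ∘ ↑ʳ-injective k i j) (N-s-∩-≡ (q∉ i∉) (q∉ j∉))
      where
      q∉ : ∀ {x} → x ∉ CQ ∪ CS → q x ∉ CQ ++ CS
      q∉ x∉ = x∉ ∘ x∈p∪q⁺ ∘ inj₁ ∘ ∈-++⁻ˡ
      s∉ : ∀ {x} → x ∉ CQ ∪ CS → s x ∉ CQ ++ CS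
      s∉ x∉ = x∉ ∘ x∈p∪q⁺ ∘ inj₂ ∘ ∈-++⁻ʳ

    IsOSet⇒AtMostOneMissingQ : IsOSet (H k) (CQ ++ CS) → AtMostOneMissing CQ
    IsOSet⇒AtMostOneMissingQ isO {i} {j} i∉CQ j∉CQ = decidable-stable (i ≟ j) λ i≢j →
      isO (s i) (s j) (i≢j ∘ ↑ʳ-injective k i j) (N-s-∩-≡ (i∉CQ ∘ ∈-++⁻ˡ) (j∉CQ ∘ ∈-++⁻ˡ))

    IsISet⇒AtMostOneMissingS : IsISet (H k) (CQ ++ CS) → AtMostOneMissing CS
    IsISet⇒AtMostOneMissingS isI {i} {j} i∉CS j∉CS = decidable-stable (i ≟ j) λ i≢j →
      isI (q i) (q j) (i≢j ∘ ↑ˡ-injective k i j) (N[q]-∩-≡ (i∉CS ∘ ∈-++⁻ʳ) (j∉CS ∘ ∈-++⁻ʳ))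

    IsISet⇒CQ⊈⁅i⁆ : IsISet (H k) (CQ ++ CS) → ∀ i → CQ ⊈ ⁅ i ⁆
    IsISet⇒CQ⊈⁅i⁆ isI i CQ⊆⁅i⁆ =
      isI (q i) (s i) (q≢s i i) (N[q]-∩-≡-N[s] (x∈⁅y⁆⇒x≡y i ∘ CQ⊆⁅i⁆ ∘ ∈-++⁻ˡ))

  IsLSet⇒k∸1≤∣C∣ : ∀ C → IsLSet (H k) C → k ∸ 1 ≤ ∣ C ∣
  IsLSet⇒k∸1≤∣C∣ = bound-via-++ λ CQ CS isL →
    ≤-trans (atMostOneMissing⇒n∸1≤∣p∣ (IsLSet⇒AtMostOneMissing∪ CQ CS isL)) (∣p∪q∣≤∣p∣+∣q∣ CQ CS)

  IsOSet⇒k∸1≤∣C∣ : ∀ C → IsOSet (H k) C → k ∸ 1 ≤ ∣ C ∣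
  IsOSet⇒k∸1≤∣C∣ C = IsLSet⇒k∸1≤∣C∣ C ∘ IsOSet⇒IsLSet (H k)

suc[n]+1≡2+n : ∀ n → suc n + 1 ≡ 2 + n
suc[n]+1≡2+n n = +-comm (suc n) 1

suc[n]+suc[n]∸2≡n+n : ∀ n → suc n + suc n ∸ 2 ≡ n + n
suc[n]+suc[n]∸2≡n+n n = cong (_∸ 1) (+-suc n n)

IsISet⇒k+1≤∣C∣ : ∀ {n} C → IsISet (H (suc n)) C → suc n + 1 ≤ ∣ C ∣
IsISet⇒k+1≤∣C∣ {n} = bound-via-++ λ CQ CS isI → begin
  suc n + 1         ≡⟨ suc[n]+1≡2+n n ⟩
  2 + n             ≤⟨ +-mono-≤ (2≤∣p∣ (IsISet⇒CQ⊈⁅i⁆ CQ CS isI))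
                                (atMostOneMissing⇒n∸1≤∣p∣ (IsISet⇒AtMostOneMissingS CQ CS isI)) ⟩
  ∣ CQ ∣ + ∣ CS ∣   ∎
  where open ≤-Reasoning

IsFSet⇒2k∸2≤∣C∣ : ∀ {n} C → IsFSet (H (suc n)) C → suc n + suc n ∸ 2 ≤ ∣ C ∣
IsFSet⇒2k∸2≤∣C∣ {n} = bound-via-++ {m = suc n} λ { CQ CS (isO , isI) → begin
  suc n + suc n ∸ 2 ≡⟨ suc[n]+suc[n]∸2≡n+n n ⟩
  n + n             ≤⟨ +-mono-≤ (atMostOneMissing⇒n∸1≤∣p∣ (IsOSet⇒AtMostOneMissingQ CQ CS isO))
                                (atMostOneMissing⇒n∸1≤∣p∣ (IsISet⇒AtMostOneMissingS CQ CS isI)) ⟩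
  ∣ CQ ∣ + ∣ CS ∣   ∎ }
  where open ≤-Reasoning

module _ {k : ℕ} (3<k : 3 < k) (r : Fin k) (CS : Subset k) where

  ∁⁅r⁆++CS-IsOSet : IsOSet (H k) (∁ ⁅ r ⁆ ++ CS)
  ∁⁅r⁆++CS-IsOSet = separating⇒IsOSet (H k) separating
    where
    C = ∁ ⁅ r ⁆ ++ CS

    q∈C : ∀ {t} → t ≢ r → q t ∈ C
    q∈C = ∈-++⁺ˡ ∘ x≢y⇒x∈∁⁅y⁆

    q-q : ∀ {i j} → i ≢ j → i ≢ r → Separates C (adj (H k) (q i)) (adj (H k) (q j))
    q-q {i} {j} i≢j i≢r = Separates-sym (separates (q∈C i≢r)
      (trans (adj-q-q j i) (cong not (⌊⌋-false (j ≟ i) (≢-sym i≢j))))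
      (irrefl (H k) (q i)))

    s-s : ∀ {i j} → i ≢ j → i ≢ r → Separates C (adj (H k) (s i)) (adj (H k) (s j))
    s-s {i} {j} i≢j i≢r = separates (q∈C i≢r)
      (trans (adj-s-q i i) (⌊⌋-true (i ≟ i) refl))
      (trans (adj-s-q j i) (⌊⌋-false (j ≟ i) (≢-sym i≢j)))

    -- q t with t ∉ {r, i, j} is adjacent to q i but not to s j; this needs k ≥ 4.
    q-s : ∀ i j → Separates C (adj (H k) (q i)) (adj (H k) (s j))
    q-s i j with ∃-≢₃ 3<k r i j
    ... | t , t≢r , t≢i , t≢j = separates (q∈C t≢r)
      (trans (adj-q-q i t) (cong not (⌊⌋-false (i ≟ t) (≢-sym t≢i))))
      (trans (adj-s-q j t) (⌊⌋-false (j ≟ t) (≢-sym t≢j)))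

    separating : ∀ {u v} → u ≢ v → Separates C (adj (H k) u) (adj (H k) v)
    separating {u} {v} u≢v with vertex {k} u | vertex {k} v
    ... | isQ i | isQ j = separated-avoiding r (adj (H k) ∘ q) q-q (u≢v ∘ cong q)
    ... | isQ i | isS j = q-s i j
    ... | isS i | isQ j = Separates-sym (q-s j i)
    ... | isS i | isS j = separated-avoiding r (adj (H k) ∘ s) s-s (u≢v ∘ cong s)

module _ {k : ℕ} {CQ : Subset k} {a b : Fin k} (a∈CQ : a ∈ CQ) (b∈CQ : b ∈ CQ) (a≢b : a ≢ b)
         (r : Fin k) where

  CQ++∁⁅r⁆-IsISet : IsISet (H k) (CQ ++ ∁ ⁅ r ⁆)
  CQ++∁⁅r⁆-IsISet = separating⇒IsISet (H k) separating
    where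
    C = CQ ++ ∁ ⁅ r ⁆

    s∈C : ∀ {t} → t ≢ r → s t ∈ C
    s∈C = ∈-++⁺ʳ ∘ x≢y⇒x∈∁⁅y⁆

    q-q : ∀ {i j} → i ≢ j → i ≢ r → Separates C (adj[ H k ] (q i)) (adj[ H k ] (q j))
    q-q {i} {j} i≢j i≢r = separates (s∈C i≢r)
      (trans (adj[]-q-s i i) (⌊⌋-true (i ≟ i) refl))
      (trans (adj[]-q-s j i) (⌊⌋-false (j ≟ i) (≢-sym i≢j)))

    s-s : ∀ {i j} → i ≢ j → i ≢ r → Separates C (adj[ H k ] (s i)) (adj[ H k ] (s j))
    s-s {i} {j} i≢j i≢r = separates (s∈C i≢r)
      (trans (adj[]-s-s i i) (⌊⌋-true (i ≟ i) refl))
      (trans (adj[]-s-s j i) (⌊⌋-false (j ≟ i) (≢-sym i≢j)))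

    q-s : ∀ i j → Separates C (adj[ H k ] (q i)) (adj[ H k ] (s j))
    q-s i j with j ≟ a
    ... | yes refl = separates (∈-++⁺ˡ b∈CQ) (adj[]-q-q i b)
                               (trans (adj[]-s-q j b) (⌊⌋-false (j ≟ b) a≢b))
    ... | no j≢a   = separates (∈-++⁺ˡ a∈CQ) (adj[]-q-q i a)
                               (trans (adj[]-s-q j a) (⌊⌋-false (j ≟ a) j≢a))

    separating : ∀ {u v} → u ≢ v → Separates C (adj[ H k ] u) (adj[ H k ] v)
    separating {u} {v} u≢v with vertex {k} u | vertex {k} v
    ... | isQ i | isQ j = separated-avoiding r (adj[ H k ] ∘ q) q-q (u≢v ∘ cong q)
    ... | isQ i | isS j = q-s i j
    ... | isS i | isQ j = Separates-sym (q-s j i)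
    ... | isS i | isS j = separated-avoiding r (adj[ H k ] ∘ s) s-s (u≢v ∘ cong s)

⁅1,2⁆ : ∀ {n} → Subset (3 + n)
⁅1,2⁆ = outside ∷ inside ∷ inside ∷ ⊥

∣∁⁅x⁆++⊥∣≡n∸1 : ∀ {n} (x : Fin n) → ∣ ∁ ⁅ x ⁆ ++ ⊥ {n} ∣ ≡ n ∸ 1
∣∁⁅x⁆++⊥∣≡n∸1 {n} x = begin
  ∣ ∁ ⁅ x ⁆ ++ ⊥ ∣           ≡⟨ ∣p++q∣≡∣p∣+∣q∣ (∁ ⁅ x ⁆) ⊥ ⟩
  ∣ ∁ ⁅ x ⁆ ∣ + ∣ ⊥ {n} ∣    ≡⟨ cong₂ _+_ (∣∁⁅x⁆∣≡n∸1 x) (∣⊥∣≡0 n) ⟩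
  n ∸ 1 + 0                  ≡⟨ +-identityʳ (n ∸ 1) ⟩
  n ∸ 1                      ∎
  where open ≡-Reasoning

∣⁅1,2⁆++∁⁅x⁆∣≡n+1 : ∀ {n} (x : Fin (3 + n)) → ∣ ⁅1,2⁆ {n} ++ ∁ ⁅ x ⁆ ∣ ≡ 3 + n + 1
∣⁅1,2⁆++∁⁅x⁆∣≡n+1 {n} x = begin
  ∣ ⁅1,2⁆ {n} ++ ∁ ⁅ x ⁆ ∣      ≡⟨ ∣p++q∣≡∣p∣+∣q∣ (⁅1,2⁆ {n}) (∁ ⁅ x ⁆) ⟩
  ∣ ⁅1,2⁆ {n} ∣ + ∣ ∁ ⁅ x ⁆ ∣   ≡⟨ cong₂ _+_ (cong (2 +_) (∣⊥∣≡0 n)) (∣∁⁅x⁆∣≡n∸1 x) ⟩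
  2 + (2 + n)                   ≡⟨ suc[n]+1≡2+n (2 + n) ⟨
  3 + n + 1                     ∎
  where open ≡-Reasoning

∣∁⁅x⁆++∁⁅y⁆∣≡n+n∸2 : ∀ {n} (x y : Fin (suc n)) → ∣ ∁ ⁅ x ⁆ ++ ∁ ⁅ y ⁆ ∣ ≡ suc n + suc n ∸ 2
∣∁⁅x⁆++∁⁅y⁆∣≡n+n∸2 {n} x y = begin
  ∣ ∁ ⁅ x ⁆ ++ ∁ ⁅ y ⁆ ∣       ≡⟨ ∣p++q∣≡∣p∣+∣q∣ (∁ ⁅ x ⁆) (∁ ⁅ y ⁆) ⟩
  ∣ ∁ ⁅ x ⁆ ∣ + ∣ ∁ ⁅ y ⁆ ∣    ≡⟨ cong₂ _+_ (∣∁⁅x⁆∣≡n∸1 x) (∣∁⁅x⁆∣≡n∸1 y) ⟩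
  n + n                        ≡⟨ suc[n]+suc[n]∸2≡n+n n ⟨
  suc n + suc n ∸ 2            ∎
  where open ≡-Reasoning

theorem6 : (k : ℕ) → 4 ≤ k →
    IsMinCard (IsLSet (H k)) (k ∸ 1)
    × IsMinCard (IsOSet (H k)) (k ∸ 1)
    × IsMinCard (IsISet (H k)) (k + 1)
    × IsMinCard (IsFSet (H k)) ((k + k) ∸ 2)
theorem6 k@(suc (suc (suc (suc m)))) 3<k@(s≤s (s≤s (s≤s (s≤s _)))) =
    ((O , IsOSet⇒IsLSet (H k) O-isO , ∣∁⁅x⁆++⊥∣≡n∸1 {k} zero) , IsLSet⇒k∸1≤∣C∣ {k})
  , ((O , O-isO , ∣∁⁅x⁆++⊥∣≡n∸1 {k} zero) , IsOSet⇒k∸1≤∣C∣ {k})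
  , ((I , I-isI , ∣⁅1,2⁆++∁⁅x⁆∣≡n+1 {suc m} zero) , IsISet⇒k+1≤∣C∣)
  , ((F , (F-isO , F-isI) , ∣∁⁅x⁆++∁⁅y⁆∣≡n+n∸2 {suc (suc (suc m))} zero zero) , IsFSet⇒2k∸2≤∣C∣)
  where
  ∁⁅0⁆ : Subset k
  ∁⁅0⁆ = ∁ ⁅ zero ⁆

  O I F : Subset (k + k)
  O = ∁⁅0⁆ ++ ⊥
  I = ⁅1,2⁆ {suc m} ++ ∁⁅0⁆
  F = ∁⁅0⁆ ++ ∁⁅0⁆

  O-isO : IsOSet (H k) O
  O-isO = ∁⁅r⁆++CS-IsOSet 3<k zero ⊥

  I-isI : IsISet (H k) I
  I-isI = CQ++∁⁅r⁆-IsISet {CQ = ⁅1,2⁆ {suc m}} (there here) (there (there here)) (λ ()) zero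

  F-isO : IsOSet (H k) F
  F-isO = ∁⁅r⁆++CS-IsOSet 3<k zero ∁⁅0⁆

  F-isI : IsISet (H k) F
  F-isI = CQ++∁⁅r⁆-IsISet {a = suc zero} {b = suc (suc zero)}
            (x≢y⇒x∈∁⁅y⁆ {y = zero} λ ()) (x≢y⇒x∈∁⁅y⁆ {y = zero} λ ()) (λ ()) zero
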